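{- Let $P$, $Q$, $R$ be dMTSs over a common alphabet $A$, where $P$ and $Q$ have disjoint state sets, and let $p\in P$, $q\in Q$, $r\in R$. Then $p\vee q\sqsubseteq_{\mathrm{dMTS}} r$ if and only if $p\sqsubseteq_{\mathrm{dMTS}} r$ and $q\sqsubseteq_{\mathrm{dMTS}} r$.
   Context: A disjunctive Modal Transition System (dMTS) is a tuple $(P,A,\longrightarrow_P,\dashrightarrow_P)$ with $P$ a set of states, $A$ an alphabet not containing the silent action $\tau$, a must-transition relation $\longrightarrow_P\subseteq P\times A\times(2^P\setminus\{\emptyset\})$ and a may-transition relation $\dashrightarrow_P\subseteq P\times(A\cup\{\tau\})\times P$, satisfying syntactic consistency: $p\xrightarrow{a}P'$ (must) implies $p\stackrel{a}{\dashrightarrow}p'$ (may) for all $p'\in P'$. Weak may-transitions: $p\stackrel{\epsilon}{\Longrightarrow}p'$ iff $p(\stackrel{\tau}{\dashrightarrow})^*p'$; for $\alpha\in A\cup\{\tau\}$, $p\stackrel{\alpha}{\Longrightarrow}p'$ iff there is $p''$ with $p\stackrel{\epsilon}{\Longrightarrow}p''\stackrel{\alpha}{\dashrightarrow}p'$. $\hat\alpha=\epsilon$ if $\alpha=\tau$, else $\hat\alpha=\alpha$. For dMTSs $P,Q$ over $A$, $\mathcal R\subseteq P\times Q$ is an observational modal refinement relation if for all $(p,q)\in\mathcal R$: (i) $q\xrightarrow{a}Q'$ implies there is $P'$ with $p\xrightarrow{a}P'$ and for every $p'\in P'$ some $q'\in Q'$ with $(p',q')\in\mathcal R$; (ii)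 $p\stackrel{\alpha}{\dashrightarrow}p'$ implies there is $q'$ with $q\stackrel{\hat\alpha}{\Longrightarrow}q'$ and $(p',q')\in\mathcal R$. $p\sqsubseteq_{\mathrm{dMTS}}q$ iff some such relation contains $(p,q)$. dMTS-disjunction: for dMTSs $P,Q$ over $A$ with disjoint state sets, $P\vee Q$ has state set $\{p\vee q: p\in P,q\in Q\}\cup P\cup Q$, alphabet $A$, and the least must- and may-transition relations containing those of $P$ and $Q$ and satisfying: (Must) $p\vee q\xrightarrow{a}P'\cup Q'$ if $p\xrightarrow{a}_PP'$ and $q\xrightarrow{a}_QQ'$; (May1) $p\vee q\stackrel{\alpha}{\dashrightarrow}p'$ if $p\stackrel{\alpha}{\dashrightarrow}_Pp'$; (May2) $p\vee q\stackrel{\alpha}{\dashrightarrow}q'$ if $q\stackrel{\alpha}{\dashrightarrow}_Qq'$. -}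

module Defs where

open import Data.Maybe using (Maybe; just; nothing)
open import Data.Product using (Σ; ∃; _×_; _,_)
open import Data.Sum using (_⊎_; inj₁; inj₂)
open import Data.Empty using (⊥)
open import Relation.Binary.Construct.Closure.ReflexiveTransitive using (Star)

-- Actions: A ∪ {τ}; τ is represented by 'nothing', visible a by 'just a'.
Act : Set → Set
Act A = Maybe A

τ : {A : Set} → Act A
τ = nothing

-- A disjunctive modal transition system over alphabet A.
-- Subsets of states are predicates St → Set.
record DMTS (A : Set) : Set₂ where
  field
    St   : Set
    Must : St → A → (St → Set) → Set₁
    May  : St → Act A → St → Set
    must-nonempty : ∀ {p a P'} → Must p a P' → Σ St P'
    consistent : ∀ {p a P' p'} → Must p a P' → P' p' → May p (just a) p'
open DMTS public

module _ {A : Set} (P : DMTS A) where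
  WeakEps : St P → St P → Set
  WeakEps = Star (λ x y → May P x τ y)

  Weak : St P → Act A → St P → Set
  Weak p α p' = Σ (St P) λ p'' → WeakEps p p'' × May P p'' α p'

  WeakHat : St P → Act A → St P → Set
  WeakHat p nothing  p' = WeakEps p p'
  WeakHat p (just a) p' = Weak p (just a) p'

record IsRefinement {A : Set} (P Q : DMTS A) (R : St P → St Q → Set) : Set₁ where
  field
    must-cond : ∀ {p q} → R p q → ∀ {a Q'} → Must Q q a Q' →
      Σ (St P → Set) λ P' → Must P p a P' ×
        (∀ p' → P' p' → Σ (St Q) λ q' → Q' q' × R p' q')
    may-cond : ∀ {p q} → R p q → ∀ {α p'} → May P p α p' →
      Σ (St Q) λ q' → WeakHat Q q α q' × R p' q'

Refines : {A : Set} (P Q : DMTS A) → St P → St Q → Set₁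
Refines P Q p q = Σ (St P → St Q → Set) λ R → IsRefinement P Q R × R p q

-- dMTS-disjunction.  States {p ∨ q} ∪ P ∪ Q, realised as a disjoint sum
-- (so the disjointness of the state sets of P and Q is built in).

module Disj {A : Set} (P Q : DMTS A) where

  data DSt : Set where
    _∨_ : St P → St Q → DSt
    inP : St P → DSt
    inQ : St Q → DSt

  ⌞_⌟P : (St P → Set) → DSt → Set
  ⌞ P' ⌟P (inP p) = P' p
  ⌞ P' ⌟P _       = ⊥

  ⌞_⌟Q : (St Q → Set) → DSt → Set
  ⌞ Q' ⌟Q (inQ q) = Q' q
  ⌞ Q' ⌟Q _       = ⊥

  _∪_ : (St P → Set) → (St Q → Set) → DSt → Set
  (P' ∪ Q') (inP p) = P' p
  (P' ∪ Q') (inQ q) = Q' q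
  (P' ∪ Q') (_ ∨ _) = ⊥

  data DMust : DSt → A → (DSt → Set) → Set₁ where
    liftP : ∀ {p a P'} → Must P p a P' → DMust (inP p) a ⌞ P' ⌟P
    liftQ : ∀ {q a Q'} → Must Q q a Q' → DMust (inQ q) a ⌞ Q' ⌟Q
    must∨ : ∀ {p q a P' Q'} → Must P p a P' → Must Q q a Q' →
            DMust (p ∨ q) a (P' ∪ Q')

  data DMay : DSt → Act A → DSt → Set where
    liftP : ∀ {p α p'} → May P p α p' → DMay (inP p) α (inP p')
    liftQ : ∀ {q α q'} → May Q q α q' → DMay (inQ q) α (inQ q')
    may1  : ∀ {p q α p'} → May P p α p' → DMay (p ∨ q) α (inP p')
    may2  : ∀ {p q α q'} → May Q q α q' → DMay (p ∨ q) α (inQ q')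

  private
    nonempty : ∀ {s a S} → DMust s a S → Σ DSt S
    nonempty (liftP m) with must-nonempty P m
    ... | p' , x = inP p' , x
    nonempty (liftQ m) with must-nonempty Q m
    ... | q' , x = inQ q' , x
    nonempty (must∨ m _) with must-nonempty P m
    ... | p' , x = inP p' , x

    cons : ∀ {s a S s'} → DMust s a S → S s' → DMay s (just a) s'
    cons {s' = inP _} (liftP m) x = liftP (consistent P m x)
    cons {s' = inQ _} (liftQ m) x = liftQ (consistent Q m x)
    cons {s' = inP _} (must∨ m _) x = may1 (consistent P m x)
    cons {s' = inQ _} (must∨ _ m) x = may2 (consistent Q m x)

  dmts : DMTS A
  dmts = record
    { St = DSt ; Must = DMust ; May = DMay
    ; must-nonempty = nonempty ; consistent = cons }

_∨ᴰ_ : {A : Set} → DMTS A → DMTS A → DMTS A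
P ∨ᴰ Q = Disj.dmts P Q

_⟨∨⟩_ : {A : Set} {P Q : DMTS A} → St P → St Q → St (P ∨ᴰ Q)
_⟨∨⟩_ {P = P} {Q} p q = Disj._∨_ {P = P} {Q} p q

-- The
-- states p and q each refine p ∨ q by a strong simulation (the transitions of
-- p ∨ q are those of p and of q), so one direction is transitivity of
-- refinement. Conversely, refinement relations for p and for q glue to one for
-- p ∨ q, since every must-transition of p ∨ q is a union of must-transitions
-- of p and of q.
module Submission where

open import Defs
open import Data.Maybe using (just; nothing)
open import Data.Product using (Σ; _×_; _,_)
open import Relation.Binary.Construct.Closure.ReflexiveTransitive using (ε; _◅_; _◅◅_)

module _ {A : Set} where

  may⇒weakHat : (S : DMTS A) {s s' : St S} {α : Act A} →
                May S s α s' → WeakHat S s α s'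
  may⇒weakHat S {α = nothing} m = m ◅ ε
  may⇒weakHat S {α = just _}  m = _ , ε , m

  weakEps-weakHat : (S : DMTS A) {s s₁ s' : St S} {α : Act A} →
                    WeakEps S s s₁ → WeakHat S s₁ α s' → WeakHat S s α s'
  weakEps-weakHat S {α = nothing} w w₁            = w ◅◅ w₁
  weakEps-weakHat S {α = just _}  w (s₂ , w₁ , m) = s₂ , w ◅◅ w₁ , m

  module _ {S R : DMTS A} {ℛ : St S → St R → Set} (ref : IsRefinement S R ℛ) where
    open IsRefinement ref

    weakEps-simulated : ∀ {s s' r} → ℛ s r → WeakEps S s s' →
                        Σ (St R) λ r' → WeakEps R r r' × ℛ s' r'
    weakEps-simulated {r = r} h ε = r , ε , h
    weakEps-simulated h (m ◅ w) with may-cond h m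
    ... | r₁ , w₁ , h₁ with weakEps-simulated h₁ w
    ... | r' , w' , h' = r' , w₁ ◅◅ w' , h'

    weakHat-simulated : ∀ {s s' r} α → ℛ s r → WeakHat S s α s' →
                        Σ (St R) λ r' → WeakHat R r α r' × ℛ s' r'
    weakHat-simulated nothing  h w = weakEps-simulated h w
    weakHat-simulated (just _) h (_ , w , m) with weakEps-simulated h w
    ... | r₁ , w₁ , h₁ with may-cond h₁ m
    ... | r' , w' , h' = r' , weakEps-weakHat R w₁ w' , h'

  ∘-isRefinement : {P S R : DMTS A} {ℛ₁ : St P → St S → Set} {ℛ₂ : St S → St R → Set} →
    IsRefinement P S ℛ₁ → IsRefinement S R ℛ₂ →
    IsRefinement P R (λ p r → Σ (St S) λ s → ℛ₁ p s × ℛ₂ s r)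
  IsRefinement.must-cond (∘-isRefinement {S = S} {R} {ℛ₁} {ℛ₂} ref₁ ref₂) (_ , h₁ , h₂) {Q' = R'} m
    with IsRefinement.must-cond ref₂ h₂ m
  ... | S' , mS , matchS with IsRefinement.must-cond ref₁ h₁ mS
  ... | P' , mP , matchP = P' , mP , match
    where
    match : ∀ p' → P' p' → Σ (St R) λ r' → R' r' × Σ (St S) λ s' → ℛ₁ p' s' × ℛ₂ s' r'
    match p' k with matchP p' k
    ... | s' , k' , h₁' with matchS s' k'
    ... | r' , k'' , h₂' = r' , k'' , (s' , h₁' , h₂')
  IsRefinement.may-cond (∘-isRefinement ref₁ ref₂) (_ , h₁ , h₂) {α} m
    with IsRefinement.may-cond ref₁ h₁ m
  ... | s' , w , h₁' with weakHat-simulated ref₂ α h₂ w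
  ... | r' , w' , h₂' = r' , w' , (s' , h₁' , h₂')

  ⊑-trans : {P S R : DMTS A} {p : St P} {s : St S} {r : St R} →
            Refines P S p s → Refines S R s r → Refines P R p r
  ⊑-trans (_ , ref₁ , h₁) (_ , ref₂ , h₂) = _ , ∘-isRefinement ref₁ ref₂ , (_ , h₁ , h₂)

module _ {A : Set} (P Q : DMTS A) where
  open Disj P Q

  data LeftOf : St P → DSt → Set where
    embedded : ∀ {p}   → LeftOf p (inP p)
    disjunct : ∀ {p q} → LeftOf p (p ∨ q)

  data RightOf : St Q → DSt → Set where
    embedded : ∀ {q}   → RightOf q (inQ q)
    disjunct : ∀ {p q} → RightOf q (p ∨ q)

  LeftOf-isRefinement : IsRefinement P (P ∨ᴰ Q) LeftOf
  IsRefinement.must-cond LeftOf-isRefinement embedded (liftP {P' = P'} m) =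
    P' , m , λ p' k → inP p' , k , embedded
  IsRefinement.must-cond LeftOf-isRefinement disjunct (must∨ {P' = P'} m _) =
    P' , m , λ p' k → inP p' , k , embedded
  IsRefinement.may-cond LeftOf-isRefinement embedded m =
    _ , may⇒weakHat (P ∨ᴰ Q) (liftP m) , embedded
  IsRefinement.may-cond LeftOf-isRefinement disjunct m =
    _ , may⇒weakHat (P ∨ᴰ Q) (may1 m) , embedded

  RightOf-isRefinement : IsRefinement Q (P ∨ᴰ Q) RightOf
  IsRefinement.must-cond RightOf-isRefinement embedded (liftQ {Q' = Q'} m) =
    Q' , m , λ q' k → inQ q' , k , embedded
  IsRefinement.must-cond RightOf-isRefinement disjunct (must∨ {Q' = Q'} _ m) =
    Q' , m , λ q' k → inQ q' , k , embedded
  IsRefinement.may-cond RightOf-isRefinement embedded m =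
    _ , may⇒weakHat (P ∨ᴰ Q) (liftQ m) , embedded
  IsRefinement.may-cond RightOf-isRefinement disjunct m =
    _ , may⇒weakHat (P ∨ᴰ Q) (may2 m) , embedded

  ∨-upperˡ : (p : St P) (q : St Q) → Refines P (P ∨ᴰ Q) p (p ∨ q)
  ∨-upperˡ p q = LeftOf , LeftOf-isRefinement , disjunct

  ∨-upperʳ : (p : St P) (q : St Q) → Refines Q (P ∨ᴰ Q) q (p ∨ q)
  ∨-upperʳ p q = RightOf , RightOf-isRefinement , disjunct

  module _ {R : DMTS A} {ℛP : St P → St R → Set} {ℛQ : St Q → St R → Set} where

    data Join : DSt → St R → Set where
      left  : ∀ {p r}   → ℛP p r → Join (inP p) r
      right : ∀ {q r}   → ℛQ q r → Join (inQ q) r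
      both  : ∀ {p q r} → ℛP p r → ℛQ q r → Join (p ∨ q) r

    Join-isRefinement : IsRefinement P R ℛP → IsRefinement Q R ℛQ →
                        IsRefinement (P ∨ᴰ Q) R Join
    IsRefinement.must-cond (Join-isRefinement refP refQ) (left h) {Q' = R'} m
      with IsRefinement.must-cond refP h m
    ... | P' , mP , matchP = ⌞ P' ⌟P , liftP mP , match
      where
      match : ∀ s → ⌞ P' ⌟P s → Σ (St R) λ r' → R' r' × Join s r'
      match (inP p') k with matchP p' k
      ... | r' , k' , h' = r' , k' , left h'
    IsRefinement.must-cond (Join-isRefinement refP refQ) (right h) {Q' = R'} m
      with IsRefinement.must-cond refQ h m
    ... | Q' , mQ , matchQ = ⌞ Q' ⌟Q , liftQ mQ , match
      where
      match : ∀ s → ⌞ Q' ⌟Q s → Σ (St R) λ r' → R' r' × Join s r'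
      match (inQ q') k with matchQ q' k
      ... | r' , k' , h' = r' , k' , right h'
    IsRefinement.must-cond (Join-isRefinement refP refQ) (both hP hQ) {Q' = R'} m
      with IsRefinement.must-cond refP hP m | IsRefinement.must-cond refQ hQ m
    ... | P' , mP , matchP | Q' , mQ , matchQ = P' ∪ Q' , must∨ mP mQ , match
      where
      match : ∀ s → (P' ∪ Q') s → Σ (St R) λ r' → R' r' × Join s r'
      match (inP p') k with matchP p' k
      ... | r' , k' , h' = r' , k' , left h'
      match (inQ q') k with matchQ q' k
      ... | r' , k' , h' = r' , k' , right h'
    IsRefinement.may-cond (Join-isRefinement refP refQ) (left h) (liftP m)
      with IsRefinement.may-cond refP h m
    ... | r' , w , h' = r' , w , left h'
    IsRefinement.may-cond (Join-isRefinement refP refQ) (right h) (liftQ m)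
      with IsRefinement.may-cond refQ h m
    ... | r' , w , h' = r' , w , right h'
    IsRefinement.may-cond (Join-isRefinement refP refQ) (both h _) (may1 m)
      with IsRefinement.may-cond refP h m
    ... | r' , w , h' = r' , w , left h'
    IsRefinement.may-cond (Join-isRefinement refP refQ) (both _ h) (may2 m)
      with IsRefinement.may-cond refQ h m
    ... | r' , w , h' = r' , w , right h'

  ∨-least : {R : DMTS A} {p : St P} {q : St Q} {r : St R} →
            Refines P R p r → Refines Q R q r → Refines (P ∨ᴰ Q) R (p ∨ q) r
  ∨-least (_ , refP , hP) (_ , refQ , hQ) = Join , Join-isRefinement refP refQ , both hP hQ

theorem3p10 : {A : Set} (P Q R : DMTS A) (p : St P) (q : St Q) (r : St R) →
    (Refines (P ∨ᴰ Q) R (_⟨∨⟩_ {P = P} {Q = Q} p q) r → Refines P R p r × Refines Q R q r)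
    × (Refines P R p r × Refines Q R q r → Refines (P ∨ᴰ Q) R (_⟨∨⟩_ {P = P} {Q = Q} p q) r)
theorem3p10 P Q _ p q _ =
  (λ p∨q⊑r → ⊑-trans (∨-upperˡ P Q p q) p∨q⊑r , ⊑-trans (∨-upperʳ P Q p q) p∨q⊑r)
  , λ (p⊑r , q⊑r) → ∨-least P Q p⊑r q⊑r
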